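{- Let $G$ be a connected graph of order $n\ge2$ whose distance Seidel eigenvalues are $\partial_1^S,\dots,\partial_n^S$. Then the distance Seidel eigenvalues of the double graph $D_2G$ are $2\partial_r^S-3$ for $r=1,\dots,n$ (each once), together with $3$ with multiplicity $n$.
   Context: For a connected graph $G$ with distance matrix $\mathcal{D}(G)$, the distance Seidel matrix is $\mathcal{D}^S(G)=J-I-2\mathcal{D}(G)$, $J$ the all-ones matrix; its eigenvalues are the distance Seidel eigenvalues. The double graph $D_2G$ of $G$ with $V(G)=\{v_1,\dots,v_n\}$ is obtained by taking a second copy with vertices $v_1',\dots,v_n'$ ($v_r'$ corresponding to $v_r$) and adding edges so that $D_2G$ has vertex set $\{v_r\}\cup\{v_r'\}$, contains $G$, and each $v_r'$ is adjacent to exactly the vertices $v_t$ and $v_t'$ with $v_t$ in the neighbourhood of $v_r$ in $G$ (equivalently $D_2G$ is $G$ with every vertex duplicated into two non-adjacent twins). -}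

module Defs where

open import Data.Nat as ℕ using (ℕ; zero; suc; _∸_)
open import Data.Integer using (+_)
open import Data.Fin as Fin using (Fin; zero; suc; splitAt; punchIn)
open import Data.Bool using (Bool; true; false; _∧_; _∨_; not; if_then_else_)
open import Data.Rational using (ℚ; 0ℚ; 1ℚ; _+_; _*_; -_; _-_; _/_)
open import Data.Sum using ([_,_])
open import Data.Product using (∃)
open import Function using (id; _∘_)
open import Relation.Nullary.Decidable using (⌊_⌋)
open import Relation.Binary.PropositionalEquality using (_≡_; refl)

record Graph (n : ℕ) : Set where
  field
    adj    : Fin n → Fin n → Bool
    sym    : ∀ u v → adj u v ≡ adj v u
    irrefl : ∀ u → adj u u ≡ false
open Graph public

_==_ : ∀ {n} → Fin n → Fin n → Bool
u == v = ⌊ u Fin.≟ v ⌋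

anyFin : ∀ {n} → (Fin n → Bool) → Bool
anyFin {zero}  f = false
anyFin {suc n} f = f zero ∨ anyFin (f ∘ suc)

-- reach G k u v = true  iff  there is a walk (equivalently a path) of
-- length at most k from u to v in G
reach : ∀ {n} → Graph n → ℕ → Fin n → Fin n → Bool
reach G zero    u v = u == v
reach G (suc k) u v = reach G k u v ∨ anyFin (λ w → reach G k u w ∧ adj G w v)

Connected : ∀ {n} → Graph n → Set
Connected G = ∀ u v → ∃ λ k → reach G k u v ≡ true

countUnreached : ∀ {n} → Graph n → ℕ → Fin n → Fin n → ℕ
countUnreached G zero    u v = 0
countUnreached G (suc m) u v =
  (if reach G m u v then 0 else 1) ℕ.+ countUnreached G m u v

-- distance d(u,v) = length of a shortest u–v path.  Since reach is
-- monotone in k, the least k with reach G k u v = true equals the number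
-- of k with reach G k u v = false; in a connected graph on n vertices
-- this k is < n, so counting over k < n gives exactly d(u,v).
dist : ∀ {n} → Graph n → Fin n → Fin n → ℕ
dist {n} G u v = countUnreached G n u v

Matrix : ℕ → Set
Matrix n = Fin n → Fin n → ℚ

ℕtoℚ : ℕ → ℚ
ℕtoℚ k = + k / 1

δ : ∀ {n} → Fin n → Fin n → ℚ
δ u v = if u == v then 1ℚ else 0ℚ

distMatrix : ∀ {n} → Graph n → Matrix n
distMatrix G u v = ℕtoℚ (dist G u v)

distSeidel : ∀ {n} → Graph n → Matrix n
distSeidel G u v = (1ℚ - δ u v) - ℕtoℚ 2 * distMatrix G u v

sumFin : ∀ {n} → (Fin n → ℚ) → ℚ
sumFin {zero}  f = 0ℚ
sumFin {suc n} f = f zero + sumFin (f ∘ suc)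

sign : ∀ {n} → Fin n → ℚ
sign zero    = 1ℚ
sign (suc j) = - sign j

minor : ∀ {n} → Matrix (suc n) → Fin (suc n) → Matrix n
minor M j a b = M (suc a) (punchIn j b)

det : ∀ {n} → Matrix n → ℚ
det {zero}  M = 1ℚ
det {suc n} M = sumFin (λ j → sign j * (M zero j * det (minor M j)))

charPoly : ∀ {n} → Matrix n → ℚ → ℚ
charPoly M x = det (λ i j → x * δ i j - M i j)

_^_ : ℚ → ℕ → ℚ
x ^ zero  = 1ℚ
x ^ suc k = x * (x ^ k)

-- Double graph D₂G on Fin (n + n): vertex i < n is v_i, vertex n + i is
-- v_i'.  Both project to v_i, and two vertices are adjacent iff their
-- projections are adjacent in G (each vertex duplicated into two
-- non-adjacent twins).

proj : ∀ {n} → Fin (n ℕ.+ n) → Fin n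
proj {n} i = [ id , id ] (splitAt n i)

double : ∀ {n} → Graph n → Graph (n ℕ.+ n)
double G = record
  { adj    = λ i j → adj G (proj i) (proj j)
  ; sym    = λ i j → sym G (proj i) (proj j)
  ; irrefl = λ i → irrefl G (proj i)
  }

module Submission where

-- In D₂G a vertex and its twin are at distance 2 (through any neighbour, which
-- exists since G is connected with n ≥ 2), while any other two vertices are at
-- the distance of their projections in G, because walks in D₂G project onto
-- walks in G of the same length and lift back. So with S = D^S(G), the matrix
-- xI − D^S(D₂G) is the block matrix [[A, B], [B, A]] with A = xI − S and
-- B = 3I − S, whose determinant is det (A − B) · det (A + B)
-- = (x − 3)ⁿ · 2ⁿ · det (((x + 3)/2) I − S).

open import Defs
open import Data.Nat using (ℕ; _≤_)
open import Data.Rational using (ℚ; _+_; _*_; _-_; ½)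
open import Relation.Binary.PropositionalEquality using (_≡_)

open import Data.Nat as ℕ using (zero; suc; _∸_)
import Data.Nat.Properties as ℕₚ
open import Data.Fin as Fin using (Fin; zero; suc; punchIn; toℕ; _↑ˡ_; _↑ʳ_; splitAt)
import Data.Fin.Properties as Finₚ
open import Data.Rational using (0ℚ; 1ℚ; -_)
import Data.Rational.Properties as ℚₚ
import Data.Bool.Properties as Boolₚ
open import Algebra.Bundles using (CommutativeMonoid)
open import Algebra.Properties.CommutativeSemigroup
  (CommutativeMonoid.commutativeSemigroup Boolₚ.∨-commutativeMonoid)
  using () renaming (interchange to ∨-interchange)
open import Data.Rational.Solver using (module +-*-Solver)
open +-*-Solver using (solve; _:+_; _:*_; _:-_; :-_; _:=_; con)
open import Data.Bool as Bool using (Bool; true; false; if_then_else_; _∧_; _∨_)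
open import Data.Maybe using (Maybe; just; nothing)
open import Data.Vec using (tabulate)
import Data.Vec.Properties as Vecₚ
open import Data.Fin.Subset using (Subset; _∈_; _⊂_; ∣_∣)
import Data.Fin.Subset.Properties as Subsetₚ
open import Data.Sum using (inj₁; inj₂; [_,_]′; _⊎_)
open import Data.Product using (∃; _,_; proj₁; proj₂; _×_)
open import Data.Empty using (⊥-elim)
open import Function using (_∘_; const; case_of_)
open import Relation.Nullary using (yes; no; ¬_; Dec)
open import Relation.Nullary.Decidable using (does; dec-true; dec-false; does-⇔)
open import Function.Bundles using (mk⇔)
open import Relation.Binary.PropositionalEquality
  using (_≢_; refl; cong; cong₂; subst; trans; module ≡-Reasoning)
  renaming (sym to ≡-sym)
open ≡-Reasoning

sumFin-cong : ∀ {n} {f g : Fin n → ℚ} → (∀ i → f i ≡ g i) → sumFin f ≡ sumFin g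
sumFin-cong {zero}  f≗g = refl
sumFin-cong {suc n} f≗g = cong₂ _+_ (f≗g zero) (sumFin-cong (f≗g ∘ suc))

sumFin-zero : ∀ {n} {f : Fin n → ℚ} → (∀ i → f i ≡ 0ℚ) → sumFin f ≡ 0ℚ
sumFin-zero {zero}  f≗0 = refl
sumFin-zero {suc n} f≗0 = cong₂ _+_ (f≗0 zero) (sumFin-zero (f≗0 ∘ suc))

sumFin-+ : ∀ {n} (f g : Fin n → ℚ) → sumFin (λ i → f i + g i) ≡ sumFin f + sumFin g
sumFin-+ {zero}  f g = refl
sumFin-+ {suc n} f g = trans (cong (f zero + g zero +_) (sumFin-+ (f ∘ suc) (g ∘ suc)))
  (solve 4 (λ a b c d → (a :+ b) :+ (c :+ d) := (a :+ c) :+ (b :+ d)) refl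
     (f zero) (g zero) (sumFin (f ∘ suc)) (sumFin (g ∘ suc)))

*-distribˡ-sumFin : ∀ {n} (c : ℚ) (f : Fin n → ℚ) → c * sumFin f ≡ sumFin (λ i → c * f i)
*-distribˡ-sumFin {zero}  c f = ℚₚ.*-zeroʳ c
*-distribˡ-sumFin {suc n} c f = trans (ℚₚ.*-distribˡ-+ c (f zero) (sumFin (f ∘ suc)))
  (cong (c * f zero +_) (*-distribˡ-sumFin c (f ∘ suc)))

*-*-distribˡ-sumFin : ∀ {n} (a b : ℚ) (f : Fin n → ℚ) →
  a * (b * sumFin f) ≡ sumFin (λ i → a * (b * f i))
*-*-distribˡ-sumFin a b f = trans (cong (a *_) (*-distribˡ-sumFin b f)) (*-distribˡ-sumFin a (λ i → b * f i))

sumFin-linear : ∀ {n} (f : Fin n → ℚ) (c : ℚ) (g : Fin n → ℚ) →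
  sumFin (λ i → f i + c * g i) ≡ sumFin f + c * sumFin g
sumFin-linear f c g =
  trans (sumFin-+ f (λ i → c * g i)) (cong (sumFin f +_) (≡-sym (*-distribˡ-sumFin c g)))

sumFin-neg : ∀ {n} (f : Fin n → ℚ) → sumFin (λ i → - f i) ≡ - sumFin f
sumFin-neg {zero}  f = refl
sumFin-neg {suc n} f = trans (cong (- f zero +_) (sumFin-neg (f ∘ suc)))
  (≡-sym (ℚₚ.neg-distrib-+ (f zero) (sumFin (f ∘ suc))))

sumFin-comm : ∀ {m n} (f : Fin m → Fin n → ℚ) →
  sumFin (λ i → sumFin (f i)) ≡ sumFin (λ j → sumFin (λ i → f i j))
sumFin-comm {zero} {n} f = ≡-sym (sumFin-zero {n} (λ _ → refl))
sumFin-comm {suc m} f = trans (cong (sumFin (f zero) +_) (sumFin-comm (f ∘ suc)))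
  (≡-sym (sumFin-+ (f zero) (λ j → sumFin (λ i → f (suc i) j))))

sumFin-split : ∀ {m k} (f : Fin (m ℕ.+ k) → ℚ) →
  sumFin f ≡ sumFin (λ i → f (i ↑ˡ k)) + sumFin (λ i → f (m ↑ʳ i))
sumFin-split {zero}      f = ≡-sym (ℚₚ.+-identityˡ (sumFin f))
sumFin-split {suc m} {k} f = trans (cong (f zero +_) (sumFin-split {m} {k} (f ∘ suc)))
  (≡-sym (ℚₚ.+-assoc (f zero) _ _))

==-refl : ∀ {n} (u : Fin n) → (u == u) ≡ true
==-refl u with u Fin.≟ u
... | yes _   = refl
... | no u≢u  = ⊥-elim (u≢u refl)

==-≢ : ∀ {n} {u v : Fin n} → u ≢ v → (u == v) ≡ false
==-≢ {u = u} {v} u≢v with u Fin.≟ v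
... | yes u≡v = ⊥-elim (u≢v u≡v)
... | no _    = refl

==-injective : ∀ {m n} {f : Fin m → Fin n} → (∀ {a b} → f a ≡ f b → a ≡ b) →
  ∀ a b → (f a == f b) ≡ (a == b)
==-injective {f = f} f-inj a b with a Fin.≟ b
... | yes refl = ==-refl (f a)
... | no a≢b   = ==-≢ (a≢b ∘ f-inj)

δ-refl : ∀ {n} (u : Fin n) → δ u u ≡ 1ℚ
δ-refl u = cong (if_then 1ℚ else 0ℚ) (==-refl u)

δ-≢ : ∀ {n} {u v : Fin n} → u ≢ v → δ u v ≡ 0ℚ
δ-≢ u≢v = cong (if_then 1ℚ else 0ℚ) (==-≢ u≢v)

δ-injective : ∀ {m n} {f : Fin m → Fin n} → (∀ {a b} → f a ≡ f b → a ≡ b) →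
  ∀ a b → δ (f a) (f b) ≡ δ a b
δ-injective f-inj a b = cong (if_then 1ℚ else 0ℚ) (==-injective f-inj a b)

det-cong : ∀ {n} {M N : Matrix n} → (∀ i j → M i j ≡ N i j) → det M ≡ det N
det-cong {zero}  M≗N = refl
det-cong {suc n} M≗N = sumFin-cong λ j →
  cong₂ (λ a d → sign j * (a * d)) (M≗N zero j) (det-cong (λ a b → M≗N (suc a) (punchIn j b)))

det-linear : ∀ {n} (M N P : Matrix n) (r : Fin n) (c : ℚ) →
  (∀ j → M r j ≡ N r j + c * P r j) →
  (∀ i → i ≢ r → ∀ j → M i j ≡ N i j) →
  (∀ i → i ≢ r → ∀ j → M i j ≡ P i j) →
  det M ≡ det N + c * det P
det-linear {suc n} M N P zero c M0≡N0+cP0 M≗N M≗P =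
  trans (sumFin-cong term) (sumFin-linear (λ j → sign j * (N zero j * det (minor N j))) c
                                          (λ j → sign j * (P zero j * det (minor P j))))
  where
  term : ∀ j → sign j * (M zero j * det (minor M j))
             ≡ sign j * (N zero j * det (minor N j)) + c * (sign j * (P zero j * det (minor P j)))
  term j = begin
    sign j * (M zero j * det (minor M j))
      ≡⟨ cong (λ a → sign j * (a * det (minor M j))) (M0≡N0+cP0 j) ⟩
    sign j * ((N zero j + c * P zero j) * det (minor M j))
      ≡⟨ solve 5 (λ s a b c d → s :* ((a :+ c :* b) :* d) := s :* (a :* d) :+ c :* (s :* (b :* d)))
           refl (sign j) (N zero j) (P zero j) c (det (minor M j)) ⟩
    sign j * (N zero j * det (minor M j)) + c * (sign j * (P zero j * det (minor M j)))
      ≡⟨ cong₂ (λ d d′ → sign j * (N zero j * d) + c * (sign j * (P zero j * d′)))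
           (det-cong (λ a b → M≗N (suc a) (λ ()) (punchIn j b)))
           (det-cong (λ a b → M≗P (suc a) (λ ()) (punchIn j b))) ⟩
    sign j * (N zero j * det (minor N j)) + c * (sign j * (P zero j * det (minor P j))) ∎
det-linear {suc n} M N P (suc r) c Mr≡Nr+cPr M≗N M≗P =
  trans (sumFin-cong term) (sumFin-linear (λ j → sign j * (N zero j * det (minor N j))) c
                                          (λ j → sign j * (P zero j * det (minor P j))))
  where
  term : ∀ j → sign j * (M zero j * det (minor M j))
             ≡ sign j * (N zero j * det (minor N j)) + c * (sign j * (P zero j * det (minor P j)))
  term j = begin
    sign j * (M zero j * det (minor M j))
      ≡⟨ cong (λ d → sign j * (M zero j * d))
           (det-linear (minor M j) (minor N j) (minor P j) r c (Mr≡Nr+cPr ∘ punchIn j)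
             (λ i i≢r b → M≗N (suc i) (i≢r ∘ Finₚ.suc-injective) (punchIn j b))
             (λ i i≢r b → M≗P (suc i) (i≢r ∘ Finₚ.suc-injective) (punchIn j b))) ⟩
    sign j * (M zero j * (det (minor N j) + c * det (minor P j)))
      ≡⟨ solve 5 (λ s a d c e → s :* (a :* (d :+ c :* e)) := s :* (a :* d) :+ c :* (s :* (a :* e)))
           refl (sign j) (M zero j) (det (minor N j)) c (det (minor P j)) ⟩
    sign j * (M zero j * det (minor N j)) + c * (sign j * (M zero j * det (minor P j)))
      ≡⟨ cong₂ (λ a a′ → sign j * (a * det (minor N j)) + c * (sign j * (a′ * det (minor P j))))
           (M≗N zero (λ ()) j) (M≗P zero (λ ()) j) ⟩
    sign j * (N zero j * det (minor N j)) + c * (sign j * (P zero j * det (minor P j))) ∎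

laplaceTail : ∀ {m} → Matrix (suc (suc m)) → ℚ
laplaceTail A = sumFin (λ j → sign (suc (suc j)) * (A zero (suc (suc j)) * det (minor A (suc (suc j)))))

-- In the expansion along row 0 the first two terms trade places, and every
-- further minor again has its first two columns swapped.
mutual
  det-swapColumns01 : ∀ {m} (M N : Matrix (suc (suc m))) →
    (∀ i → N i zero ≡ M i (suc zero)) → (∀ i → N i (suc zero) ≡ M i zero) →
    (∀ i j → N i (suc (suc j)) ≡ M i (suc (suc j))) → det N ≡ - det M
  det-swapColumns01 M N N0≡M1 N1≡M0 N≗M = begin
    1ℚ * (N zero zero * det (minor N zero))
      + (- 1ℚ * (N zero (suc zero) * det (minor N (suc zero))) + laplaceTail N)
      ≡⟨ cong₂ (λ a b → 1ℚ * a + (- 1ℚ * b + laplaceTail N))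
           (cong₂ _*_ (N0≡M1 zero) minorN0) (cong₂ _*_ (N1≡M0 zero) minorN1) ⟩
    1ℚ * (m01 * d1) + (- 1ℚ * (m00 * d0) + laplaceTail N)
      ≡⟨ cong (λ t → 1ℚ * (m01 * d1) + (- 1ℚ * (m00 * d0) + t))
           (laplaceTail-swap M N N0≡M1 N1≡M0 N≗M) ⟩
    1ℚ * (m01 * d1) + (- 1ℚ * (m00 * d0) + - laplaceTail M)
      ≡⟨ solve 5 (λ b d₁ a d₀ t → con 1ℚ :* (b :* d₁) :+ (:- con 1ℚ :* (a :* d₀) :+ (:- t))
                      := :- (con 1ℚ :* (a :* d₀) :+ (:- con 1ℚ :* (b :* d₁) :+ t)))
           refl m01 d1 m00 d0 (laplaceTail M) ⟩
    - det M ∎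
    where
    m00 = M zero zero
    m01 = M zero (suc zero)
    d0 = det (minor M zero)
    d1 = det (minor M (suc zero))

    minorN0 : det (minor N zero) ≡ d1
    minorN0 = det-cong {M = minor N zero} {N = minor M (suc zero)}
      λ { a zero → N1≡M0 (suc a) ; a (suc b) → N≗M (suc a) b }

    minorN1 : det (minor N (suc zero)) ≡ d0
    minorN1 = det-cong {M = minor N (suc zero)} {N = minor M zero}
      λ { a zero → N0≡M1 (suc a) ; a (suc b) → N≗M (suc a) b }

  laplaceTail-swap : ∀ {m} (M N : Matrix (suc (suc m))) →
    (∀ i → N i zero ≡ M i (suc zero)) → (∀ i → N i (suc zero) ≡ M i zero) →
    (∀ i j → N i (suc (suc j)) ≡ M i (suc (suc j))) → laplaceTail N ≡ - laplaceTail M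
  laplaceTail-swap {zero}  M N N0≡M1 N1≡M0 N≗M = refl
  laplaceTail-swap {suc m} M N N0≡M1 N1≡M0 N≗M =
    trans (sumFin-cong term)
      (sumFin-neg (λ j → sign (suc (suc j)) * (M zero (suc (suc j)) * det (minor M (suc (suc j))))))
    where
    term : ∀ j → sign (suc (suc j)) * (N zero (suc (suc j)) * det (minor N (suc (suc j))))
               ≡ - (sign (suc (suc j)) * (M zero (suc (suc j)) * det (minor M (suc (suc j)))))
    term j = trans
      (cong₂ (λ a d → sign (suc (suc j)) * (a * d)) (N≗M zero j)
        (det-swapColumns01 (minor M (suc (suc j))) (minor N (suc (suc j)))
          (N0≡M1 ∘ suc) (N1≡M0 ∘ suc) (λ i k → N≗M (suc i) (punchIn j k))))
      (solve 3 (λ s a d → s :* (a :* (:- d)) := :- (s :* (a :* d)))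
        refl (sign (suc (suc j))) (M zero (suc (suc j))) (det (minor M (suc (suc j)))))

minorAt : ∀ {n} → Matrix (suc n) → Fin (suc n) → Fin (suc n) → Matrix n
minorAt M i j a b = M (punchIn i a) (punchIn j b)

det-expandColumn0 : ∀ {n} (M : Matrix (suc n)) →
  det M ≡ sumFin (λ i → sign i * (M i zero * det (minorAt M i zero)))
det-expandColumn0 {zero}  M = refl
det-expandColumn0 {suc m} M = cong (1ℚ * (M zero zero * det (minor M zero)) +_) (begin
  sumFin (λ j → sign (suc j) * (M zero (suc j) * det (minor M (suc j))))
    ≡⟨ sumFin-cong (λ j → expandMinor j) ⟩
  sumFin (λ j → sumFin (λ i → sign (suc j) * (M zero (suc j) * (sign i * (M (suc i) zero * D i j)))))
    ≡⟨ sumFin-comm (λ j i → sign (suc j) * (M zero (suc j) * (sign i * (M (suc i) zero * D i j)))) ⟩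
  sumFin (λ i → sumFin (λ j → sign (suc j) * (M zero (suc j) * (sign i * (M (suc i) zero * D i j)))))
    ≡⟨ sumFin-cong (λ i → ≡-sym (expandMinorAt i)) ⟩
  sumFin (λ i → sign (suc i) * (M (suc i) zero * det (minorAt M (suc i) zero))) ∎)
  where
  D : Fin (suc m) → Fin (suc m) → ℚ
  D i j = det (λ a b → M (suc (punchIn i a)) (suc (punchIn j b)))

  expandMinor : ∀ j → sign (suc j) * (M zero (suc j) * det (minor M (suc j)))
    ≡ sumFin (λ i → sign (suc j) * (M zero (suc j) * (sign i * (M (suc i) zero * D i j))))
  expandMinor j = trans
    (cong (λ d → sign (suc j) * (M zero (suc j) * d)) (det-expandColumn0 (minor M (suc j))))
    (*-*-distribˡ-sumFin (sign (suc j)) (M zero (suc j)) (λ i → sign i * (M (suc i) zero * D i j)))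

  expandMinorAt : ∀ i → sign (suc i) * (M (suc i) zero * det (minorAt M (suc i) zero))
    ≡ sumFin (λ j → sign (suc j) * (M zero (suc j) * (sign i * (M (suc i) zero * D i j))))
  expandMinorAt i = trans
    (*-*-distribˡ-sumFin (sign (suc i)) (M (suc i) zero) (λ j → sign j * (M zero (suc j) * D i j)))
    (sumFin-cong (λ j → solve 5 (λ sᵢ sⱼ a b d → (:- sᵢ) :* (b :* (sⱼ :* (a :* d)))
                                                := (:- sⱼ) :* (a :* (sᵢ :* (b :* d))))
                            refl (sign i) (sign j) (M zero (suc j)) (M (suc i) zero) (D i j)))

transpose : ∀ {n} → Matrix n → Matrix n
transpose M i j = M j i

det-transpose : ∀ {n} (M : Matrix n) → det (transpose M) ≡ det M
det-transpose {zero}  M = refl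
det-transpose {suc n} M = trans
  (sumFin-cong (λ i → cong (λ d → sign i * (M i zero * d)) (det-transpose (minorAt M i zero))))
  (≡-sym (det-expandColumn0 M))

x≡-x⇒x≡0 : ∀ (x : ℚ) → x ≡ - x → x ≡ 0ℚ
x≡-x⇒x≡0 x x≡-x = begin
  x              ≡⟨ solve 1 (λ x → x := (x :+ x) :* con ½) refl x ⟩
  (x + x) * ½    ≡⟨ cong (λ y → (x + y) * ½) x≡-x ⟩
  (x + - x) * ½  ≡⟨ solve 1 (λ x → (x :+ :- x) :* con ½ := con 0ℚ) refl x ⟩
  0ℚ             ∎

det-equalRows01 : ∀ {m} (M : Matrix (suc (suc m))) → (∀ j → M zero j ≡ M (suc zero) j) → det M ≡ 0ℚ
det-equalRows01 M M0≡M1 = trans (≡-sym (det-transpose M))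
  (x≡-x⇒x≡0 _ (det-swapColumns01 (transpose M) (transpose M) M0≡M1 (≡-sym ∘ M0≡M1) (λ _ _ → refl)))

replaceRow : ∀ {n} → Matrix n → Fin n → (Fin n → ℚ) → Matrix n
replaceRow M p v i j = if i == p then v j else M i j

replaceRow-at : ∀ {n} (M : Matrix n) p v j → replaceRow M p v p j ≡ v j
replaceRow-at M p v j = cong (if_then v j else M p j) (==-refl p)

replaceRow-off : ∀ {n} (M : Matrix n) p v {i} → i ≢ p → ∀ j → replaceRow M p v i j ≡ M i j
replaceRow-off M p v {i} i≢p j = cong (if_then v j else M i j) (==-≢ i≢p)

mutual
  det-equalRows : ∀ {n} (M : Matrix n) (p q : Fin n) → p ≢ q → (∀ j → M p j ≡ M q j) → det M ≡ 0ℚ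
  det-equalRows         M zero    zero    p≢q _     = ⊥-elim (p≢q refl)
  det-equalRows {suc n} M zero    (suc q) _   M0≡Mq = det-equalRow0 {n} M q M0≡Mq
  det-equalRows {suc n} M (suc p) zero    _   Mp≡M0 = det-equalRow0 {n} M p (≡-sym ∘ Mp≡M0)
  det-equalRows {suc n} M (suc p) (suc q) p≢q Mp≡Mq = det-equalRows-suc {n} M p q (p≢q ∘ cong suc) Mp≡Mq

  det-equalRows-suc : ∀ {n} (M : Matrix (suc n)) (p q : Fin n) → p ≢ q →
    (∀ j → M (suc p) j ≡ M (suc q) j) → det M ≡ 0ℚ
  det-equalRows-suc {n} M p q p≢q Mp≡Mq = sumFin-zero λ j → trans
    (cong (λ d → sign j * (M zero j * d)) (det-equalRows {n} (minor M j) p q p≢q (Mp≡Mq ∘ punchIn j)))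
    (solve 2 (λ s a → s :* (a :* con 0ℚ) := con 0ℚ) refl (sign j) (M zero j))

  -- Put w = M_q + M₁ into row q (giving A) and then also into row 1 (giving N):
  -- linearity in these rows relates det M to determinants with two equal rows.
  det-equalRow0 : ∀ {n} (M : Matrix (suc n)) (q : Fin n) → (∀ j → M zero j ≡ M (suc q) j) → det M ≡ 0ℚ
  det-equalRow0 M zero    M0≡M1 = det-equalRows01 M M0≡M1
  det-equalRow0 {suc n} M (suc q) M0≡MQ = begin
    det M                   ≡⟨ solve 1 (λ a → a := a :+ con 1ℚ :* con 0ℚ) refl (det M) ⟩
    det M + 1ℚ * 0ℚ         ≡⟨ cong (λ d → det M + 1ℚ * d)
                                   (≡-sym (det-equalRows-suc {suc n} B zero (suc q) (λ ()) B-one≡B-Q)) ⟩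
    det M + 1ℚ * det B      ≡⟨ ≡-sym (det-linear A M B Q 1ℚ A-Q (λ i i≢Q → replaceRow-off M Q w i≢Q)
                                        (λ i i≢Q j → trans (replaceRow-off M Q w i≢Q j)
                                                            (≡-sym (replaceRow-off M Q (M one) i≢Q j)))) ⟩
    det A                   ≡⟨ solve 1 (λ a → a := con 0ℚ :+ con 1ℚ :* a) refl (det A) ⟩
    0ℚ + 1ℚ * det A         ≡⟨ cong (_+ 1ℚ * det A) (≡-sym det-P≡0) ⟩
    det P + 1ℚ * det A      ≡⟨ ≡-sym (det-linear N P A one 1ℚ N-one
                                        (λ i i≢1 j → trans (replaceRow-off A one w i≢1 j)
                                                            (≡-sym (replaceRow-off A one (M Q) i≢1 j)))
                                        (λ i i≢1 → replaceRow-off A one w i≢1)) ⟩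
    det N                   ≡⟨ det-equalRows-suc {suc n} N zero (suc q) (λ ()) N-one≡N-Q ⟩
    0ℚ                      ∎
    where
    one Q : Fin _
    one = suc zero
    Q = suc (suc q)
    w : Fin _ → ℚ
    w j = M Q j + 1ℚ * M one j
    A N P B : Matrix _
    A = replaceRow M Q w
    N = replaceRow A one w
    P = replaceRow A one (M Q)
    B = replaceRow M Q (M one)

    A-Q : ∀ j → A Q j ≡ M Q j + 1ℚ * B Q j
    A-Q j = trans (replaceRow-at M Q w j) (cong (λ x → M Q j + 1ℚ * x) (≡-sym (replaceRow-at M Q (M one) j)))

    N-one : ∀ j → N one j ≡ P one j + 1ℚ * A one j
    N-one j = trans (replaceRow-at A one w j)
      (≡-sym (cong₂ (λ x y → x + 1ℚ * y) (replaceRow-at A one (M Q) j) (replaceRow-off M Q w (λ ()) j)))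

    B-one≡B-Q : ∀ j → B one j ≡ B Q j
    B-one≡B-Q j = trans (replaceRow-off M Q (M one) (λ ()) j) (≡-sym (replaceRow-at M Q (M one) j))

    det-P≡0 : det P ≡ 0ℚ
    det-P≡0 = det-equalRows01 P (λ j → begin
      P zero j  ≡⟨ replaceRow-off A one (M Q) {zero} (λ ()) j ⟩
      A zero j  ≡⟨ replaceRow-off M Q w {zero} (λ ()) j ⟩
      M zero j  ≡⟨ M0≡MQ j ⟩
      M Q j     ≡⟨ ≡-sym (replaceRow-at A one (M Q) j) ⟩
      P one j   ∎)

    N-one≡N-Q : ∀ j → N one j ≡ N Q j
    N-one≡N-Q j = begin
      N one j   ≡⟨ replaceRow-at A one w j ⟩
      w j       ≡⟨ ≡-sym (replaceRow-at M Q w j) ⟩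
      A Q j     ≡⟨ ≡-sym (replaceRow-off A one w (λ ()) j) ⟩
      N Q j     ∎

det-addRowMultiple : ∀ {n} (M N : Matrix n) (p q : Fin n) (c : ℚ) → p ≢ q →
  (∀ j → N p j ≡ M p j + c * M q j) → (∀ i → i ≢ p → ∀ j → N i j ≡ M i j) → det N ≡ det M
det-addRowMultiple M N p q c p≢q Np≡Mp+cMq N≗M = begin
  det N              ≡⟨ det-linear N M P p c N-p N≗M N≗P ⟩
  det M + c * det P  ≡⟨ cong (λ d → det M + c * d) det-P≡0 ⟩
  det M + c * 0ℚ     ≡⟨ solve 2 (λ a c → a :+ c :* con 0ℚ := a) refl (det M) c ⟩
  det M              ∎
  where
  P = replaceRow M p (M q)

  N-p : ∀ j → N p j ≡ M p j + c * P p j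
  N-p j = trans (Np≡Mp+cMq j) (cong (λ x → M p j + c * x) (≡-sym (replaceRow-at M p (M q) j)))

  N≗P : ∀ i → i ≢ p → ∀ j → N i j ≡ P i j
  N≗P i i≢p j = trans (N≗M i i≢p j) (≡-sym (replaceRow-off M p (M q) i≢p j))

  det-P≡0 : det P ≡ 0ℚ
  det-P≡0 = det-equalRows P p q p≢q
    (λ j → trans (replaceRow-at M p (M q) j) (≡-sym (replaceRow-off M p (M q) (p≢q ∘ ≡-sym) j)))

does-<?-suc : ∀ {x k} → x ≢ k → does (x ℕ.<? suc k) ≡ does (x ℕ.<? k)
does-<?-suc {x} {k} x≢k =
  does-⇔ (mk⇔ (λ x<1+k → ℕₚ.≤∧≢⇒< (ℕₚ.m<1+n⇒m≤n x<1+k) x≢k) ℕₚ.m<n⇒m<1+n) (x ℕ.<? suc k) (x ℕ.<? k)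

-- Adds c · (row src r) to row dst r for every r at once; dst⁻¹ is a partial
-- inverse of dst, and no source row is a destination row.
module AddRowMultiples {N n : ℕ} (dst src : Fin n → Fin N) (dst⁻¹ : Fin N → Maybe (Fin n))
  (dst⁻¹-dst : ∀ r → dst⁻¹ (dst r) ≡ just r)
  (dst⁻¹-just : ∀ {i r} → dst⁻¹ i ≡ just r → i ≡ dst r)
  (dst⁻¹-src : ∀ r → dst⁻¹ (src r) ≡ nothing)
  (M : Matrix N) (c : ℚ) where

  -- partial k has carried out the additions for the r with toℕ r < k.
  rowAfter : ℕ → Maybe (Fin n) → Fin N → Fin N → ℚ
  rowAfter k nothing  i j = M i j
  rowAfter k (just r) i j = if does (toℕ r ℕ.<? k) then M i j + c * M (src r) j else M i j

  partial : ℕ → Matrix N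
  partial k i = rowAfter k (dst⁻¹ i) i

  partial-dst-done : ∀ {k} r j → toℕ r ℕ.< k → partial k (dst r) j ≡ M (dst r) j + c * M (src r) j
  partial-dst-done {k} r j r<k = trans (cong (λ m → rowAfter k m (dst r) j) (dst⁻¹-dst r))
    (cong (if_then M (dst r) j + c * M (src r) j else M (dst r) j) (dec-true (toℕ r ℕ.<? k) r<k))

  partial-dst-pending : ∀ {k} r j → ¬ toℕ r ℕ.< k → partial k (dst r) j ≡ M (dst r) j
  partial-dst-pending {k} r j r≮k = trans (cong (λ m → rowAfter k m (dst r) j) (dst⁻¹-dst r))
    (cong (if_then M (dst r) j + c * M (src r) j else M (dst r) j) (dec-false (toℕ r ℕ.<? k) r≮k))

  partial-src : ∀ k r j → partial k (src r) j ≡ M (src r) j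
  partial-src k r j = cong (λ m → rowAfter k m (src r) j) (dst⁻¹-src r)

  partial-zero : ∀ i j → partial 0 i j ≡ M i j
  partial-zero i j = rowAfter-zero (dst⁻¹ i)
    where
    rowAfter-zero : ∀ m → rowAfter 0 m i j ≡ M i j
    rowAfter-zero nothing  = refl
    rowAfter-zero (just r) = refl

  det-partial-suc : ∀ k → k ℕ.< n → det (partial (suc k)) ≡ det (partial k)
  det-partial-suc k k<n =
    det-addRowMultiple (partial k) (partial (suc k)) (dst r) (src r) c dst≢src updated unchanged
    where
    r = Fin.fromℕ< k<n
    r≡k : toℕ r ≡ k
    r≡k = Finₚ.toℕ-fromℕ< k<n

    dst≢src : dst r ≢ src r
    dst≢src eq with () ← trans (≡-sym (dst⁻¹-dst r)) (trans (cong dst⁻¹ eq) (dst⁻¹-src r))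

    updated : ∀ j → partial (suc k) (dst r) j ≡ partial k (dst r) j + c * partial k (src r) j
    updated j = trans (partial-dst-done r j (ℕₚ.≤-reflexive (cong suc r≡k)))
      (≡-sym (cong₂ (λ a b → a + c * b) (partial-dst-pending r j (ℕₚ.<-irrefl r≡k)) (partial-src k r j)))

    unchanged : ∀ i → i ≢ dst r → ∀ j → partial (suc k) i j ≡ partial k i j
    unchanged i i≢dst j with dst⁻¹ i in eq
    ... | nothing = refl
    ... | just s  = cong (if_then M i j + c * M (src s) j else M i j)
                      (does-<?-suc (λ s≡k → i≢dst (trans (dst⁻¹-just eq)
                        (cong dst (Finₚ.toℕ-injective (trans s≡k (≡-sym r≡k)))))))

  det-partial : ∀ k → k ℕ.≤ n → det (partial k) ≡ det M
  det-partial zero    _   = det-cong partial-zero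
  det-partial (suc k) k<n = trans (det-partial-suc k k<n) (det-partial k (ℕₚ.<⇒≤ k<n))

  det-addRowMultiples : (P : Matrix N) →
    (∀ r j → P (dst r) j ≡ M (dst r) j + c * M (src r) j) →
    (∀ i → dst⁻¹ i ≡ nothing → ∀ j → P i j ≡ M i j) → det P ≡ det M
  det-addRowMultiples P P-dst P-other = trans (det-cong P≗partial) (det-partial n ℕₚ.≤-refl)
    where
    P≗partial : ∀ i j → P i j ≡ partial n i j
    P≗partial i j with dst⁻¹ i in eq
    ... | nothing = P-other i eq j
    ... | just r with refl ← dst⁻¹-just eq = trans (P-dst r j)
          (≡-sym (cong (if_then M (dst r) j + c * M (src r) j else M (dst r) j)
                    (dec-true (toℕ r ℕ.<? n) (Finₚ.toℕ<n r))))

punchIn-↑ˡ-↑ˡ : ∀ {m k} (j : Fin (suc m)) (s : Fin m) →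
  punchIn (j ↑ˡ k) (s ↑ˡ k) ≡ punchIn j s ↑ˡ k
punchIn-↑ˡ-↑ˡ zero    s       = refl
punchIn-↑ˡ-↑ˡ (suc j) zero    = refl
punchIn-↑ˡ-↑ˡ (suc j) (suc s) = cong suc (punchIn-↑ˡ-↑ˡ j s)

punchIn-↑ˡ-↑ʳ : ∀ {m k} (j : Fin (suc m)) (s : Fin k) → punchIn (j ↑ˡ k) (m ↑ʳ s) ≡ suc m ↑ʳ s
punchIn-↑ˡ-↑ʳ         zero    s = refl
punchIn-↑ˡ-↑ʳ {suc m} (suc j) s = cong suc (punchIn-↑ˡ-↑ʳ j s)

sign-↑ˡ : ∀ {m k} (j : Fin m) → sign (j ↑ˡ k) ≡ sign j
sign-↑ˡ zero    = refl
sign-↑ˡ (suc j) = cong -_ (sign-↑ˡ j)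

det-blockLowerTriangular : ∀ {m k} (M : Matrix (m ℕ.+ k)) → (∀ r s → M (r ↑ˡ k) (m ↑ʳ s) ≡ 0ℚ) →
  det M ≡ det (λ r s → M (r ↑ˡ k) (s ↑ˡ k)) * det (λ r s → M (m ↑ʳ r) (m ↑ʳ s))
det-blockLowerTriangular {zero}      M _      = ≡-sym (ℚₚ.*-identityˡ (det M))
det-blockLowerTriangular {suc m} {k} M upper≡0 = begin
  det M
    ≡⟨ sumFin-split {suc m} {k} (λ j → sign j * (M zero j * det (minor M j))) ⟩
  sumFin (λ j → sign (j ↑ˡ k) * (M zero (j ↑ˡ k) * det (minor M (j ↑ˡ k))))
    + sumFin (λ s → sign (suc m ↑ʳ s) * (M zero (suc m ↑ʳ s) * det (minor M (suc m ↑ʳ s))))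
    ≡⟨ cong₂ _+_ (sumFin-cong left) (sumFin-zero right) ⟩
  sumFin (λ j → det BR * (sign j * (TL zero j * det (minor TL j)))) + 0ℚ
    ≡⟨ ℚₚ.+-identityʳ _ ⟩
  sumFin (λ j → det BR * (sign j * (TL zero j * det (minor TL j))))
    ≡⟨ ≡-sym (*-distribˡ-sumFin (det BR) (λ j → sign j * (TL zero j * det (minor TL j)))) ⟩
  det BR * det TL
    ≡⟨ ℚₚ.*-comm (det BR) (det TL) ⟩
  det TL * det BR ∎
  where
  TL : Matrix (suc m)
  TL r s = M (r ↑ˡ k) (s ↑ˡ k)
  BR : Matrix k
  BR r s = M (suc m ↑ʳ r) (suc m ↑ʳ s)

  left : ∀ j → sign (j ↑ˡ k) * (M zero (j ↑ˡ k) * det (minor M (j ↑ˡ k)))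
             ≡ det BR * (sign j * (TL zero j * det (minor TL j)))
  left j = begin
    sign (j ↑ˡ k) * (M zero (j ↑ˡ k) * det (minor M (j ↑ˡ k)))
      ≡⟨ cong₂ (λ s d → s * (M zero (j ↑ˡ k) * d)) (sign-↑ˡ {k = k} j)
           (det-blockLowerTriangular (minor M (j ↑ˡ k))
             (λ r s → trans (cong (M (suc (r ↑ˡ k))) (punchIn-↑ˡ-↑ʳ j s)) (upper≡0 (suc r) s))) ⟩
    sign j * (TL zero j * (det (λ r s → M (suc (r ↑ˡ k)) (punchIn (j ↑ˡ k) (s ↑ˡ k)))
                           * det (λ r s → M (suc (m ↑ʳ r)) (punchIn (j ↑ˡ k) (m ↑ʳ s)))))
      ≡⟨ cong₂ (λ d d′ → sign j * (TL zero j * (d * d′)))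
           (det-cong (λ r s → cong (M (suc (r ↑ˡ k))) (punchIn-↑ˡ-↑ˡ j s)))
           (det-cong (λ r s → cong (M (suc (m ↑ʳ r))) (punchIn-↑ˡ-↑ʳ j s))) ⟩
    sign j * (TL zero j * (det (minor TL j) * det BR))
      ≡⟨ solve 4 (λ s a d b → s :* (a :* (d :* b)) := b :* (s :* (a :* d)))
           refl (sign j) (TL zero j) (det (minor TL j)) (det BR) ⟩
    det BR * (sign j * (TL zero j * det (minor TL j))) ∎

  right : ∀ s → sign (suc m ↑ʳ s) * (M zero (suc m ↑ʳ s) * det (minor M (suc m ↑ʳ s))) ≡ 0ℚ
  right s = trans (cong (λ a → sign (suc m ↑ʳ s) * (a * det (minor M (suc m ↑ʳ s)))) (upper≡0 zero s))
    (solve 2 (λ σ d → σ :* (con 0ℚ :* d) := con 0ℚ)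
      refl (sign (suc m ↑ʳ s)) (det (minor M (suc m ↑ʳ s))))

det-scalarMatrix : ∀ {n} (D : Matrix n) (c : ℚ) → (∀ i j → D i j ≡ c * δ i j) → det D ≡ c ^ n
det-scalarMatrix {zero}  D c D≡cI = refl
det-scalarMatrix {suc n} D c D≡cI = begin
  1ℚ * (D zero zero * det (minor D zero)) + offDiagonal
    ≡⟨ cong₂ (λ a d → 1ℚ * (a * d) + offDiagonal) (D≡cI zero zero)
         (det-scalarMatrix (minor D zero) c
           (λ a b → trans (D≡cI (suc a) (suc b)) (cong (c *_) (δ-injective Finₚ.suc-injective a b)))) ⟩
  1ℚ * (c * 1ℚ * c ^ n) + offDiagonal
    ≡⟨ cong (1ℚ * (c * 1ℚ * c ^ n) +_) (sumFin-zero offDiagonal≡0) ⟩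
  1ℚ * (c * 1ℚ * c ^ n) + 0ℚ
    ≡⟨ solve 2 (λ c p → con 1ℚ :* ((c :* con 1ℚ) :* p) :+ con 0ℚ := c :* p) refl c (c ^ n) ⟩
  c ^ suc n ∎
  where
  offDiagonal = sumFin (λ j → sign (suc j) * (D zero (suc j) * det (minor D (suc j))))

  offDiagonal≡0 : ∀ j → sign (suc j) * (D zero (suc j) * det (minor D (suc j))) ≡ 0ℚ
  offDiagonal≡0 j = trans (cong (λ a → sign (suc j) * (a * det (minor D (suc j)))) (D≡cI zero (suc j)))
    (solve 3 (λ s c d → s :* ((c :* con 0ℚ) :* d) := con 0ℚ) refl (sign (suc j)) c (det (minor D (suc j))))

det-scale : ∀ {n} (M N : Matrix n) (c : ℚ) → (∀ i j → N i j ≡ c * M i j) → det N ≡ c ^ n * det M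
det-scale {zero}  M N c N≡cM = ≡-sym (ℚₚ.*-identityˡ 1ℚ)
det-scale {suc n} M N c N≡cM = begin
  sumFin (λ j → sign j * (N zero j * det (minor N j)))
    ≡⟨ sumFin-cong term ⟩
  sumFin (λ j → c ^ suc n * (sign j * (M zero j * det (minor M j))))
    ≡⟨ ≡-sym (*-distribˡ-sumFin (c ^ suc n) (λ j → sign j * (M zero j * det (minor M j)))) ⟩
  c ^ suc n * det M ∎
  where
  term : ∀ j → sign j * (N zero j * det (minor N j)) ≡ c ^ suc n * (sign j * (M zero j * det (minor M j)))
  term j = trans
    (cong₂ (λ a d → sign j * (a * d)) (N≡cM zero j)
      (det-scale (minor M j) (minor N j) c (λ a b → N≡cM (suc a) (punchIn j b))))
    (solve 5 (λ s c a p d → s :* ((c :* a) :* (p :* d)) := (c :* p) :* (s :* (a :* d)))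
      refl (sign j) c (M zero j) (c ^ n) (det (minor M j)))

data Half {n} : Fin (n ℕ.+ n) → Set where
  upper : ∀ r → Half (r ↑ˡ n)
  lower : ∀ r → Half (n ↑ʳ r)

half : ∀ {n} (i : Fin (n ℕ.+ n)) → Half i
half {n} i with splitAt n i in eq
... | inj₁ r = subst Half (Finₚ.splitAt⁻¹-↑ˡ eq) (upper r)
... | inj₂ r = subst Half (Finₚ.splitAt⁻¹-↑ʳ eq) (lower r)

↑ˡ≢↑ʳ : ∀ {n} (r s : Fin n) → r ↑ˡ n ≢ n ↑ʳ s
↑ˡ≢↑ʳ {n} r s eq
  with () ← trans (≡-sym (Finₚ.splitAt-↑ˡ n r n)) (trans (cong (splitAt n) eq) (Finₚ.splitAt-↑ʳ n n s))

inUpper inLower : ∀ {n} → Fin (n ℕ.+ n) → Maybe (Fin n)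
inUpper {n} i = [ just , const nothing ]′ (splitAt n i)
inLower {n} i = [ const nothing , just ]′ (splitAt n i)

module _ {n : ℕ} (r : Fin n) where
  inUpper-↑ˡ : inUpper {n} (r ↑ˡ n) ≡ just r
  inUpper-↑ˡ rewrite Finₚ.splitAt-↑ˡ n r n = refl

  inUpper-↑ʳ : inUpper {n} (n ↑ʳ r) ≡ nothing
  inUpper-↑ʳ rewrite Finₚ.splitAt-↑ʳ n n r = refl

  inLower-↑ˡ : inLower {n} (r ↑ˡ n) ≡ nothing
  inLower-↑ˡ rewrite Finₚ.splitAt-↑ˡ n r n = refl

  inLower-↑ʳ : inLower {n} (n ↑ʳ r) ≡ just r
  inLower-↑ʳ rewrite Finₚ.splitAt-↑ʳ n n r = refl

inUpper-just : ∀ {n} {i : Fin (n ℕ.+ n)} {r} → inUpper {n} i ≡ just r → i ≡ r ↑ˡ n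
inUpper-just {n} {i} eq with half {n} i
... | upper s with refl ← trans (≡-sym (inUpper-↑ˡ s)) eq = refl
... | lower s with () ← trans (≡-sym (inUpper-↑ʳ s)) eq

inLower-just : ∀ {n} {i : Fin (n ℕ.+ n)} {r} → inLower {n} i ≡ just r → i ≡ n ↑ʳ r
inLower-just {n} {i} eq with half {n} i
... | upper s with () ← trans (≡-sym (inLower-↑ˡ s)) eq
... | lower s with refl ← trans (≡-sym (inLower-↑ʳ s)) eq = refl

det-addColumnMultiples : ∀ {N n} (dst src : Fin n → Fin N) (dst⁻¹ : Fin N → Maybe (Fin n)) →
  (∀ r → dst⁻¹ (dst r) ≡ just r) → (∀ {i r} → dst⁻¹ i ≡ just r → i ≡ dst r) →
  (∀ r → dst⁻¹ (src r) ≡ nothing) → (M P : Matrix N) (c : ℚ) →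
  (∀ r i → P i (dst r) ≡ M i (dst r) + c * M i (src r)) →
  (∀ j → dst⁻¹ j ≡ nothing → ∀ i → P i j ≡ M i j) → det P ≡ det M
det-addColumnMultiples dst src dst⁻¹ dst⁻¹-dst dst⁻¹-just dst⁻¹-src M P c P-dst P-other = begin
  det P              ≡⟨ ≡-sym (det-transpose P) ⟩
  det (transpose P)  ≡⟨ AddRowMultiples.det-addRowMultiples dst src dst⁻¹ dst⁻¹-dst dst⁻¹-just dst⁻¹-src
                          (transpose M) c (transpose P) P-dst P-other ⟩
  det (transpose M)  ≡⟨ det-transpose M ⟩
  det M              ∎

blocks : ∀ {n} (A B C D : Matrix n) → Matrix (n ℕ.+ n)
blocks {n} A B C D i j =
  [ (λ r → [ A r , B r ]′ (splitAt n j)) , (λ r → [ C r , D r ]′ (splitAt n j)) ]′ (splitAt n i)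

module _ {n : ℕ} (A B C D : Matrix n) (r s : Fin n) where
  blocks-↑ˡ-↑ˡ : blocks A B C D (r ↑ˡ n) (s ↑ˡ n) ≡ A r s
  blocks-↑ˡ-↑ˡ rewrite Finₚ.splitAt-↑ˡ n r n | Finₚ.splitAt-↑ˡ n s n = refl

  blocks-↑ˡ-↑ʳ : blocks A B C D (r ↑ˡ n) (n ↑ʳ s) ≡ B r s
  blocks-↑ˡ-↑ʳ rewrite Finₚ.splitAt-↑ˡ n r n | Finₚ.splitAt-↑ʳ n n s = refl

  blocks-↑ʳ-↑ˡ : blocks A B C D (n ↑ʳ r) (s ↑ˡ n) ≡ C r s
  blocks-↑ʳ-↑ˡ rewrite Finₚ.splitAt-↑ʳ n n r | Finₚ.splitAt-↑ˡ n s n = refl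

  blocks-↑ʳ-↑ʳ : blocks A B C D (n ↑ʳ r) (n ↑ʳ s) ≡ D r s
  blocks-↑ʳ-↑ʳ rewrite Finₚ.splitAt-↑ʳ n n r | Finₚ.splitAt-↑ʳ n n s = refl

det-blocks-addLowerToUpper : ∀ {n} (A B C D : Matrix n) (c : ℚ) →
  det (blocks (λ r s → A r s + c * C r s) (λ r s → B r s + c * D r s) C D) ≡ det (blocks A B C D)
det-blocks-addLowerToUpper {n} A B C D c =
  AddRowMultiples.det-addRowMultiples (_↑ˡ n) (n ↑ʳ_) inUpper inUpper-↑ˡ inUpper-just inUpper-↑ʳ M c P
    P-upper P-lower
  where
  A′ B′ : Matrix n
  A′ r s = A r s + c * C r s
  B′ r s = B r s + c * D r s
  M P : Matrix (n ℕ.+ n)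
  M = blocks A B C D
  P = blocks A′ B′ C D

  P-upper : ∀ r j → P (r ↑ˡ n) j ≡ M (r ↑ˡ n) j + c * M (n ↑ʳ r) j
  P-upper r j with half {n} j
  ... | upper s = trans (blocks-↑ˡ-↑ˡ A′ B′ C D r s)
                    (≡-sym (cong₂ (λ a b → a + c * b) (blocks-↑ˡ-↑ˡ A B C D r s) (blocks-↑ʳ-↑ˡ A B C D r s)))
  ... | lower s = trans (blocks-↑ˡ-↑ʳ A′ B′ C D r s)
                    (≡-sym (cong₂ (λ a b → a + c * b) (blocks-↑ˡ-↑ʳ A B C D r s) (blocks-↑ʳ-↑ʳ A B C D r s)))

  P-lower : ∀ i → inUpper {n} i ≡ nothing → ∀ j → P i j ≡ M i j
  P-lower i i∉upper j with half {n} i | half {n} j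
  ... | upper r | _       with () ← trans (≡-sym (inUpper-↑ˡ r)) i∉upper
  ... | lower r | upper s = trans (blocks-↑ʳ-↑ˡ A′ B′ C D r s) (≡-sym (blocks-↑ʳ-↑ˡ A B C D r s))
  ... | lower r | lower s = trans (blocks-↑ʳ-↑ʳ A′ B′ C D r s) (≡-sym (blocks-↑ʳ-↑ʳ A B C D r s))

det-blocks-addLeftToRight : ∀ {n} (A B C D : Matrix n) (c : ℚ) →
  det (blocks A (λ r s → B r s + c * A r s) C (λ r s → D r s + c * C r s)) ≡ det (blocks A B C D)
det-blocks-addLeftToRight {n} A B C D c =
  det-addColumnMultiples (n ↑ʳ_) (_↑ˡ n) inLower inLower-↑ʳ inLower-just inLower-↑ˡ M P c P-right P-left
  where
  B′ D′ : Matrix n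
  B′ r s = B r s + c * A r s
  D′ r s = D r s + c * C r s
  M P : Matrix (n ℕ.+ n)
  M = blocks A B C D
  P = blocks A B′ C D′

  P-right : ∀ s i → P i (n ↑ʳ s) ≡ M i (n ↑ʳ s) + c * M i (s ↑ˡ n)
  P-right s i with half {n} i
  ... | upper r = trans (blocks-↑ˡ-↑ʳ A B′ C D′ r s)
                    (≡-sym (cong₂ (λ a b → a + c * b) (blocks-↑ˡ-↑ʳ A B C D r s) (blocks-↑ˡ-↑ˡ A B C D r s)))
  ... | lower r = trans (blocks-↑ʳ-↑ʳ A B′ C D′ r s)
                    (≡-sym (cong₂ (λ a b → a + c * b) (blocks-↑ʳ-↑ʳ A B C D r s) (blocks-↑ʳ-↑ˡ A B C D r s)))

  P-left : ∀ j → inLower {n} j ≡ nothing → ∀ i → P i j ≡ M i j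
  P-left j j∉lower i with half {n} i | half {n} j
  ... | _       | lower s with () ← trans (≡-sym (inLower-↑ʳ s)) j∉lower
  ... | upper r | upper s = trans (blocks-↑ˡ-↑ˡ A B′ C D′ r s) (≡-sym (blocks-↑ˡ-↑ˡ A B C D r s))
  ... | lower r | upper s = trans (blocks-↑ʳ-↑ˡ A B′ C D′ r s) (≡-sym (blocks-↑ʳ-↑ˡ A B C D r s))

-- Subtract the lower block row from the upper one, then add the left block
-- column to the right one: the result is block lower triangular.
det-blocks-twin : ∀ {n} (A B : Matrix n) →
  det (blocks A B B A) ≡ det (λ r s → A r s - B r s) * det (λ r s → A r s + B r s)
det-blocks-twin {n} A B = begin
  det (blocks A B B A)
    ≡⟨ det-blocks-addLowerToUpper A B B A (- 1ℚ) ⟨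
  det (blocks A-B B-A B A)
    ≡⟨ det-blocks-addLeftToRight A-B B-A B A 1ℚ ⟨
  det E
    ≡⟨ det-blockLowerTriangular E (λ r s → trans (blocks-↑ˡ-↑ʳ A-B O B A+B r s) (O≡0 r s)) ⟩
  det (λ r s → E (r ↑ˡ n) (s ↑ˡ n)) * det (λ r s → E (n ↑ʳ r) (n ↑ʳ s))
    ≡⟨ cong₂ _*_ (det-cong (λ r s → trans (blocks-↑ˡ-↑ˡ A-B O B A+B r s) (A-B-entries r s)))
                 (det-cong (λ r s → trans (blocks-↑ʳ-↑ʳ A-B O B A+B r s) (A+B-entries r s))) ⟩
  det (λ r s → A r s - B r s) * det (λ r s → A r s + B r s) ∎
  where
  A-B B-A O A+B : Matrix n
  A-B r s = A r s + - 1ℚ * B r s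
  B-A r s = B r s + - 1ℚ * A r s
  O   r s = B-A r s + 1ℚ * A-B r s
  A+B r s = A r s + 1ℚ * B r s
  E : Matrix (n ℕ.+ n)
  E = blocks A-B O B A+B

  O≡0 : ∀ r s → O r s ≡ 0ℚ
  O≡0 r s = solve 2 (λ a b → (b :+ (:- con 1ℚ) :* a) :+ con 1ℚ :* (a :+ (:- con 1ℚ) :* b) := con 0ℚ)
              refl (A r s) (B r s)

  A-B-entries : ∀ r s → A-B r s ≡ A r s - B r s
  A-B-entries r s = solve 2 (λ a b → a :+ (:- con 1ℚ) :* b := a :- b) refl (A r s) (B r s)

  A+B-entries : ∀ r s → A+B r s ≡ A r s + B r s
  A+B-entries r s = solve 2 (λ a b → a :+ con 1ℚ :* b := a :+ b) refl (A r s) (B r s)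

anyFin-cong : ∀ {n} {f g : Fin n → Bool} → (∀ i → f i ≡ g i) → anyFin f ≡ anyFin g
anyFin-cong {zero}  f≗g = refl
anyFin-cong {suc n} f≗g = cong₂ _∨_ (f≗g zero) (anyFin-cong (f≗g ∘ suc))

anyFin-∨ : ∀ {n} (f g : Fin n → Bool) → anyFin (λ i → f i ∨ g i) ≡ anyFin f ∨ anyFin g
anyFin-∨ {zero}  f g = refl
anyFin-∨ {suc n} f g = trans (cong ((f zero ∨ g zero) ∨_) (anyFin-∨ (f ∘ suc) (g ∘ suc)))
  (∨-interchange (f zero) (g zero) (anyFin (f ∘ suc)) (anyFin (g ∘ suc)))

anyFin-split : ∀ {m k} (f : Fin (m ℕ.+ k) → Bool) →
  anyFin f ≡ anyFin (λ i → f (i ↑ˡ k)) ∨ anyFin (λ i → f (m ↑ʳ i))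
anyFin-split {zero}      f = refl
anyFin-split {suc m} {k} f = trans (cong (f zero ∨_) (anyFin-split {m} {k} (f ∘ suc)))
  (≡-sym (Boolₚ.∨-assoc (f zero) _ _))

anyFin-true : ∀ {n} (f : Fin n → Bool) w → f w ≡ true → anyFin f ≡ true
anyFin-true f zero    fw≡true rewrite fw≡true = refl
anyFin-true f (suc w) fw≡true =
  trans (cong (f zero ∨_) (anyFin-true (f ∘ suc) w fw≡true)) (Boolₚ.∨-zeroʳ (f zero))

anyFin-false : ∀ {n} (f : Fin n → Bool) → (∀ w → f w ≡ false) → anyFin f ≡ false
anyFin-false {zero}  f f≗false = refl
anyFin-false {suc n} f f≗false = cong₂ _∨_ (f≗false zero) (anyFin-false (f ∘ suc) (f≗false ∘ suc))

anyFin-witness : ∀ {n} (f : Fin n → Bool) → anyFin f ≡ true → ∃ λ w → f w ≡ true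
anyFin-witness {suc n} f any≡true with f zero in f0
... | true  = zero , f0
... | false = let (w , fw) = anyFin-witness (f ∘ suc) any≡true in suc w , fw

reach⁺ : ∀ {n} → Graph n → ℕ → Fin n → Fin n → Bool
reach⁺ G zero    u v = false
reach⁺ G (suc k) u v = reach⁺ G k u v ∨ anyFin (λ w → reach G k u w ∧ adj G w v)

reach≡==∨reach⁺ : ∀ {n} (G : Graph n) k u v → reach G k u v ≡ (u == v) ∨ reach⁺ G k u v
reach≡==∨reach⁺ G zero    u v = ≡-sym (Boolₚ.∨-identityʳ (u == v))
reach≡==∨reach⁺ G (suc k) u v =
  trans (cong (_∨ anyFin (λ w → reach G k u w ∧ adj G w v)) (reach≡==∨reach⁺ G k u v))
    (Boolₚ.∨-assoc (u == v) (reach⁺ G k u v) _)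

reach-+ : ∀ {n} (G : Graph n) d {k u v} → reach G k u v ≡ true → reach G (d ℕ.+ k) u v ≡ true
reach-+ G zero    reached = reached
reach-+ G (suc d) {k} {u} {v} reached =
  cong (_∨ anyFin (λ w → reach G (d ℕ.+ k) u w ∧ adj G w v)) (reach-+ G d reached)

reach⁺-+ : ∀ {n} (G : Graph n) d {k u v} → reach⁺ G k u v ≡ true → reach⁺ G (d ℕ.+ k) u v ≡ true
reach⁺-+ G zero    reached = reached
reach⁺-+ G (suc d) {k} {u} {v} reached =
  cong (_∨ anyFin (λ w → reach G (d ℕ.+ k) u w ∧ adj G w v)) (reach⁺-+ G d reached)

reach⁺-last-edge : ∀ {n} (G : Graph n) k {u v} → reach⁺ G k u v ≡ true → ∃ λ w → adj G w v ≡ true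
reach⁺-last-edge G (suc k) {u} {v} reached with reach⁺ G k u v in earlier
... | true  = reach⁺-last-edge G k earlier
... | false = let (w , step) = anyFin-witness (λ w → reach G k u w ∧ adj G w v) reached
              in w , Boolₚ.∧-conicalʳ _ _ step

hasNeighbour : ∀ {n} (G : Graph n) → 2 ≤ n → Connected G → ∀ u → ∃ λ w → adj G u w ≡ true
hasNeighbour {suc zero}    G (ℕ.s≤s ()) _ _
hasNeighbour {suc (suc m)} G _ connected u =
  let (k , reached)   = connected v u
      (w , adj-w-u)   = reach⁺-last-edge G k
                          (trans (≡-sym (cong (_∨ reach⁺ G k v u) (==-≢ (Finₚ.punchInᵢ≢i u zero))))
                            (trans (≡-sym (reach≡==∨reach⁺ G k v u)) reached))
  in w , trans (sym G u w) adj-w-u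
  where
  v = punchIn u zero

proj-↑ˡ : ∀ {n} (r : Fin n) → proj {n} (r ↑ˡ n) ≡ r
proj-↑ˡ {n} r rewrite Finₚ.splitAt-↑ˡ n r n = refl

proj-↑ʳ : ∀ {n} (r : Fin n) → proj {n} (n ↑ʳ r) ≡ r
proj-↑ʳ {n} r rewrite Finₚ.splitAt-↑ʳ n n r = refl

==-twins : ∀ {n} (i : Fin (n ℕ.+ n)) (r : Fin n) → (i == (r ↑ˡ n)) ∨ (i == (n ↑ʳ r)) ≡ (proj i == r)
==-twins {n} i r with half {n} i
... | upper s = begin
  ((s ↑ˡ n) == (r ↑ˡ n)) ∨ ((s ↑ˡ n) == (n ↑ʳ r))  ≡⟨ cong₂ _∨_ (==-injective (Finₚ.↑ˡ-injective n _ _) s r)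
                                                                 (==-≢ (↑ˡ≢↑ʳ s r)) ⟩
  (s == r) ∨ false                                  ≡⟨ Boolₚ.∨-identityʳ (s == r) ⟩
  s == r                                            ≡⟨ cong (_== r) (≡-sym (proj-↑ˡ s)) ⟩
  proj (s ↑ˡ n) == r                                ∎
... | lower s = begin
  ((n ↑ʳ s) == (r ↑ˡ n)) ∨ ((n ↑ʳ s) == (n ↑ʳ r))  ≡⟨ cong₂ _∨_ (==-≢ (↑ˡ≢↑ʳ r s ∘ ≡-sym))
                                                                 (==-injective (Finₚ.↑ʳ-injective n _ _) s r) ⟩
  s == r                                            ≡⟨ cong (_== r) (≡-sym (proj-↑ʳ s)) ⟩
  proj (n ↑ʳ s) == r                                ∎

reach⁺-double : ∀ {n} (G : Graph n) k (i j : Fin (n ℕ.+ n)) →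
  reach⁺ (double G) k i j ≡ reach⁺ G k (proj i) (proj j)
reach⁺-double         G zero    i j = refl
reach⁺-double {n} G (suc k) i j = cong₂ _∨_ (reach⁺-double G k i j) (begin
  anyFin (λ w → reach D k i w ∧ edge (proj w))
    ≡⟨ anyFin-split {n} {n} (λ w → reach D k i w ∧ edge (proj w)) ⟩
  anyFin (λ r → reach D k i (r ↑ˡ n) ∧ edge (proj (r ↑ˡ n)))
    ∨ anyFin (λ r → reach D k i (n ↑ʳ r) ∧ edge (proj (n ↑ʳ r)))
    ≡⟨ ≡-sym (anyFin-∨ (λ r → reach D k i (r ↑ˡ n) ∧ edge (proj (r ↑ˡ n)))
                       (λ r → reach D k i (n ↑ʳ r) ∧ edge (proj (n ↑ʳ r)))) ⟩
  anyFin (λ r → (reach D k i (r ↑ˡ n) ∧ edge (proj (r ↑ˡ n)))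
                ∨ (reach D k i (n ↑ʳ r) ∧ edge (proj (n ↑ʳ r))))
    ≡⟨ anyFin-cong step ⟩
  anyFin (λ r → reach G k (proj i) r ∧ edge r) ∎)
  where
  D = double G
  edge : Fin n → Bool
  edge r = adj G r (proj j)

  reach-twins : ∀ r → reach D k i (r ↑ˡ n) ∨ reach D k i (n ↑ʳ r) ≡ reach G k (proj i) r
  reach-twins r = begin
    reach D k i (r ↑ˡ n) ∨ reach D k i (n ↑ʳ r)
      ≡⟨ cong₂ _∨_ (reach≡==∨reach⁺ D k i (r ↑ˡ n)) (reach≡==∨reach⁺ D k i (n ↑ʳ r)) ⟩
    ((i == (r ↑ˡ n)) ∨ reach⁺ D k i (r ↑ˡ n)) ∨ ((i == (n ↑ʳ r)) ∨ reach⁺ D k i (n ↑ʳ r))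
      ≡⟨ cong₂ (λ a b → ((i == (r ↑ˡ n)) ∨ a) ∨ ((i == (n ↑ʳ r)) ∨ b))
           (trans (reach⁺-double G k i (r ↑ˡ n)) (cong (reach⁺ G k (proj i)) (proj-↑ˡ r)))
           (trans (reach⁺-double G k i (n ↑ʳ r)) (cong (reach⁺ G k (proj i)) (proj-↑ʳ r))) ⟩
    ((i == (r ↑ˡ n)) ∨ reach⁺ G k (proj i) r) ∨ ((i == (n ↑ʳ r)) ∨ reach⁺ G k (proj i) r)
      ≡⟨ ∨-interchange (i == (r ↑ˡ n)) (reach⁺ G k (proj i) r)
                       (i == (n ↑ʳ r)) (reach⁺ G k (proj i) r) ⟩
    ((i == (r ↑ˡ n)) ∨ (i == (n ↑ʳ r))) ∨ (reach⁺ G k (proj i) r ∨ reach⁺ G k (proj i) r)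
      ≡⟨ cong₂ _∨_ (==-twins i r) (Boolₚ.∨-idem _) ⟩
    (proj i == r) ∨ reach⁺ G k (proj i) r
      ≡⟨ ≡-sym (reach≡==∨reach⁺ G k (proj i) r) ⟩
    reach G k (proj i) r ∎

  step : ∀ r →
    (reach D k i (r ↑ˡ n) ∧ edge (proj (r ↑ˡ n))) ∨ (reach D k i (n ↑ʳ r) ∧ edge (proj (n ↑ʳ r)))
      ≡ reach G k (proj i) r ∧ edge r
  step r = begin
    (reach D k i (r ↑ˡ n) ∧ edge (proj (r ↑ˡ n))) ∨ (reach D k i (n ↑ʳ r) ∧ edge (proj (n ↑ʳ r)))
      ≡⟨ cong₂ (λ a b → (reach D k i (r ↑ˡ n) ∧ edge a) ∨ (reach D k i (n ↑ʳ r) ∧ edge b))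
           (proj-↑ˡ r) (proj-↑ʳ r) ⟩
    (reach D k i (r ↑ˡ n) ∧ edge r) ∨ (reach D k i (n ↑ʳ r) ∧ edge r)
      ≡⟨ ≡-sym (Boolₚ.∧-distribʳ-∨ (edge r) (reach D k i (r ↑ˡ n)) (reach D k i (n ↑ʳ r))) ⟩
    (reach D k i (r ↑ˡ n) ∨ reach D k i (n ↑ʳ r)) ∧ edge r
      ≡⟨ cong (_∧ edge r) (reach-twins r) ⟩
    reach G k (proj i) r ∧ edge r ∎

reach-double : ∀ {n} (G : Graph n) k (i j : Fin (n ℕ.+ n)) →
  reach (double G) k i j ≡ (i == j) ∨ reach⁺ G k (proj i) (proj j)
reach-double G k i j = trans (reach≡==∨reach⁺ (double G) k i j) (cong ((i == j) ∨_) (reach⁺-double G k i j))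

∈-tabulate⁺ : ∀ {n} {f : Fin n → Bool} {v} → f v ≡ true → v ∈ tabulate f
∈-tabulate⁺ {f = f} {v} fv≡true =
  Vecₚ.lookup⇒[]= v (tabulate f) (trans (Vecₚ.lookup∘tabulate f v) fv≡true)

∈-tabulate⁻ : ∀ {n} {f : Fin n → Bool} {v} → v ∈ tabulate f → f v ≡ true
∈-tabulate⁻ {f = f} {v} v∈f = trans (≡-sym (Vecₚ.lookup∘tabulate f v)) (Vecₚ.[]=⇒lookup v∈f)

monotone-change : ∀ {a b} → (a ≡ true → b ≡ true) → b ≢ a → a ≡ false × b ≡ true
monotone-change {true}  {b}     a⇒b b≢a = ⊥-elim (b≢a (a⇒b refl))
monotone-change {false} {true}  a⇒b b≢a = refl , refl
monotone-change {false} {false} a⇒b b≢a = ⊥-elim (b≢a refl)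

-- The balls around u grow strictly until they stabilise and hold at most n vertices.
module Saturation {n} (G : Graph n) (u : Fin n) where

  Stable : ℕ → Set
  Stable k = ∀ v → reach G (suc k) u v ≡ reach G k u v

  stable-suc : ∀ {k} → Stable k → Stable (suc k)
  stable-suc {k} stable v = begin
    reach G (suc k) u v ∨ anyFin (λ w → reach G (suc k) u w ∧ adj G w v)
      ≡⟨ cong (reach G (suc k) u v ∨_) (anyFin-cong (λ w → cong (_∧ adj G w v) (stable w))) ⟩
    (reach G k u v ∨ new) ∨ new
      ≡⟨ Boolₚ.∨-assoc (reach G k u v) new new ⟩
    reach G k u v ∨ (new ∨ new)
      ≡⟨ cong (reach G k u v ∨_) (Boolₚ.∨-idem new) ⟩
    reach G (suc k) u v ∎
    where
    new = anyFin (λ w → reach G k u w ∧ adj G w v)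

  stable-+ : ∀ {k} → Stable k → ∀ d → Stable (d ℕ.+ k)
  stable-+ stable zero    = stable
  stable-+ {k} stable (suc d) = stable-suc {d ℕ.+ k} (stable-+ stable d)

  stable-reach : ∀ {k} → Stable k → ∀ d v → reach G (d ℕ.+ k) u v ≡ reach G k u v
  stable-reach stable zero    v = refl
  stable-reach {k} stable (suc d) v = trans (stable-+ {k} stable d v) (stable-reach stable d v)

  ball : ℕ → Subset n
  ball k = tabulate (reach G k u)

  ball-grows : ∀ {k} → ¬ Stable k → ball k ⊂ ball (suc k)
  ball-grows {k} unstable with Finₚ.¬∀⟶∃¬ n _ (λ v → reach G (suc k) u v Bool.≟ reach G k u v) unstable
  ... | v , changed =
    (λ w∈ball → ∈-tabulate⁺ (reach-+ G 1 {k} (∈-tabulate⁻ w∈ball))) , v , ∈-tabulate⁺ (proj₂ v-new) ,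
    (λ v∈ball → case (trans (≡-sym (proj₁ v-new)) (∈-tabulate⁻ v∈ball)) of λ ())
    where
    v-new = monotone-change (reach-+ G 1 {k}) changed

  stable-or-growing : ∀ k → (∃ λ k′ → k′ ℕ.≤ k × Stable k′) ⊎ k ℕ.< ∣ ball k ∣
  stable-or-growing zero = inj₂ (subst (ℕ._< ∣ ball 0 ∣) (Subsetₚ.∣⊥∣≡0 n)
    (Subsetₚ.p⊂q⇒∣p∣<∣q∣ (Subsetₚ.⊥⊆ , u , ∈-tabulate⁺ (==-refl u) , Subsetₚ.∉⊥)))
  stable-or-growing (suc k) with stable-or-growing k
  ... | inj₁ (k′ , k′≤k , stable) = inj₁ (k′ , ℕₚ.m≤n⇒m≤1+n k′≤k , stable)
  ... | inj₂ k<∣ball∣ with Finₚ.all? (λ v → reach G (suc k) u v Bool.≟ reach G k u v)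
  ...   | yes stable  = inj₁ (k , ℕₚ.n≤1+n k , stable)
  ...   | no unstable =
    inj₂ (ℕₚ.≤-trans (ℕ.s≤s k<∣ball∣) (Subsetₚ.p⊂q⇒∣p∣<∣q∣ (ball-grows {k} unstable)))

  stabilises : ∃ λ k → k ℕ.≤ n × Stable k
  stabilises with stable-or-growing n
  ... | inj₁ found     = found
  ... | inj₂ n<∣ball∣ =
    ⊥-elim (ℕₚ.<-irrefl refl (ℕₚ.<-≤-trans n<∣ball∣ (Subsetₚ.∣p∣≤n (ball n))))

reach-saturated : ∀ {n} (G : Graph n) → Connected G → ∀ u v {K} → n ≤ K → reach G K u v ≡ true
reach-saturated G connected u v {K} n≤K with Saturation.stabilises G u | connected u v
... | k , k≤n , stable | j , reached = begin
  reach G K u v              ≡⟨ cong (λ m → reach G m u v) (≡-sym (ℕₚ.m∸n+n≡m (ℕₚ.≤-trans k≤n n≤K))) ⟩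
  reach G (K ∸ k ℕ.+ k) u v  ≡⟨ stable-reach stable (K ∸ k) v ⟩
  reach G k u v              ≡⟨ ≡-sym (stable-reach stable j v) ⟩
  reach G (j ℕ.+ k) u v      ≡⟨ cong (λ m → reach G m u v) (ℕₚ.+-comm j k) ⟩
  reach G (k ℕ.+ j) u v      ≡⟨ reach-+ G k reached ⟩
  true                       ∎
  where open Saturation G u

countFalse : (ℕ → Bool) → ℕ → ℕ
countFalse f zero    = 0
countFalse f (suc m) = (if f m then 0 else 1) ℕ.+ countFalse f m

countUnreached≡countFalse : ∀ {n} (G : Graph n) m u v →
  countUnreached G m u v ≡ countFalse (λ k → reach G k u v) m
countUnreached≡countFalse G zero    u v = refl
countUnreached≡countFalse G (suc m) u v =
  cong ((if reach G m u v then 0 else 1) ℕ.+_) (countUnreached≡countFalse G m u v)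

countFalse-cong : ∀ {f g : ℕ → Bool} → (∀ k → f k ≡ g k) → ∀ m → countFalse f m ≡ countFalse g m
countFalse-cong f≗g zero    = refl
countFalse-cong f≗g (suc m) = cong₂ (λ b c → (if b then 0 else 1) ℕ.+ c) (f≗g m) (countFalse-cong f≗g m)

countFalse-saturated : ∀ f m → (∀ k → m ≤ k → f k ≡ true) →
  ∀ d → countFalse f (d ℕ.+ m) ≡ countFalse f m
countFalse-saturated f m saturated zero    = refl
countFalse-saturated f m saturated (suc d)
  rewrite saturated (d ℕ.+ m) (ℕₚ.m≤n+m m d) = countFalse-saturated f m saturated d

countFalse-true : ∀ f → (∀ k → f k ≡ true) → ∀ m → countFalse f m ≡ 0
countFalse-true f f≗true zero    = refl
countFalse-true f f≗true (suc m) rewrite f≗true m = countFalse-true f f≗true m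

dist-refl : ∀ {n} (G : Graph n) u → dist G u u ≡ 0
dist-refl {n} G u = trans (countUnreached≡countFalse G n u u) (countFalse-true _ reach-refl n)
  where
  reach-refl : ∀ k → reach G k u u ≡ true
  reach-refl k = trans (reach≡==∨reach⁺ G k u u) (cong (_∨ reach⁺ G k u u) (==-refl u))

dist-double : ∀ {n} (G : Graph n) → Connected G → ∀ {i j} → proj {n} i ≢ proj j →
  dist (double G) i j ≡ dist G (proj i) (proj j)
dist-double {n} G connected {i} {j} proj-i≢proj-j = begin
  dist (double G) i j
    ≡⟨ countUnreached≡countFalse (double G) (n ℕ.+ n) i j ⟩
  countFalse (λ k → reach (double G) k i j) (n ℕ.+ n)
    ≡⟨ countFalse-cong reach-same (n ℕ.+ n) ⟩
  countFalse (λ k → reach G k (proj i) (proj j)) (n ℕ.+ n)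
    ≡⟨ countFalse-saturated _ n (λ k → reach-saturated G connected (proj i) (proj j)) n ⟩
  countFalse (λ k → reach G k (proj i) (proj j)) n
    ≡⟨ ≡-sym (countUnreached≡countFalse G n (proj i) (proj j)) ⟩
  dist G (proj i) (proj j) ∎
  where
  reach-same : ∀ k → reach (double G) k i j ≡ reach G k (proj i) (proj j)
  reach-same k = begin
    reach (double G) k i j
      ≡⟨ reach-double G k i j ⟩
    (i == j) ∨ reach⁺ G k (proj i) (proj j)
      ≡⟨ cong (_∨ reach⁺ G k (proj i) (proj j))
           (trans (==-≢ (proj-i≢proj-j ∘ cong proj)) (≡-sym (==-≢ proj-i≢proj-j))) ⟩
    (proj i == proj j) ∨ reach⁺ G k (proj i) (proj j)
      ≡⟨ reach≡==∨reach⁺ G k (proj i) (proj j) ⟨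
    reach G k (proj i) (proj j) ∎

-- Twins are joined by a walk of length 2 through a neighbour, but not by an edge.
dist-double-twins : ∀ {n} (G : Graph n) → 2 ≤ n → Connected G →
  ∀ {i j} → i ≢ j → proj {n} i ≡ proj j → dist (double G) i j ≡ 2
dist-double-twins {n} G 2≤n connected {i} {j} i≢j proj-i≡proj-j = begin
  dist (double G) i j
    ≡⟨ countUnreached≡countFalse (double G) (n ℕ.+ n) i j ⟩
  countFalse (λ k → reach (double G) k i j) (n ℕ.+ n)
    ≡⟨ countFalse-cong reach-closed (n ℕ.+ n) ⟩
  countFalse closedWalk (n ℕ.+ n)
    ≡⟨ cong (countFalse closedWalk) (≡-sym (ℕₚ.m∸n+n≡m 2≤n+n)) ⟩
  countFalse closedWalk (n ℕ.+ n ∸ 2 ℕ.+ 2)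
    ≡⟨ countFalse-saturated closedWalk 2 closedWalk-saturated (n ℕ.+ n ∸ 2) ⟩
  countFalse closedWalk 2
    ≡⟨ cong (λ b → (if b then 0 else 1) ℕ.+ 1) noLoop ⟩
  2 ∎
  where
  u = proj i
  closedWalk : ℕ → Bool
  closedWalk k = reach⁺ G k u u

  2≤n+n : 2 ≤ n ℕ.+ n
  2≤n+n = ℕₚ.≤-trans 2≤n (ℕₚ.m≤m+n n n)

  reach-closed : ∀ k → reach (double G) k i j ≡ closedWalk k
  reach-closed k = trans (reach-double G k i j)
    (cong₂ _∨_ (==-≢ i≢j) (cong (reach⁺ G k u) (≡-sym proj-i≡proj-j)))

  noLoop : reach⁺ G 1 u u ≡ false
  noLoop = anyFin-false (λ w → (u == w) ∧ adj G w u) noEdge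
    where
    noEdge : ∀ w → (u == w) ∧ adj G w u ≡ false
    noEdge w with u Fin.≟ w
    ... | yes refl = irrefl G u
    ... | no _     = refl

  closedWalk₂ : reach⁺ G 2 u u ≡ true
  closedWalk₂ =
    let (w , adj-u-w) = hasNeighbour G 2≤n connected u
        reach-w : reach G 1 u w ≡ true
        reach-w = trans (cong ((u == w) ∨_) (anyFin-true _ u (cong₂ _∧_ (==-refl u) adj-u-w)))
                        (Boolₚ.∨-zeroʳ (u == w))
    in trans (cong (reach⁺ G 1 u u ∨_) (anyFin-true _ w (cong₂ _∧_ reach-w (trans (sym G w u) adj-u-w))))
             (Boolₚ.∨-zeroʳ (reach⁺ G 1 u u))

  closedWalk-saturated : ∀ k → 2 ≤ k → closedWalk k ≡ true
  closedWalk-saturated k 2≤k =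
    subst (λ m → closedWalk m ≡ true) (ℕₚ.m∸n+n≡m 2≤k) (reach⁺-+ G (k ∸ 2) closedWalk₂)

seidelEntry : ℚ → ℕ → ℚ
seidelEntry d m = (1ℚ - d) - ℕtoℚ 2 * ℕtoℚ m

distSeidel-refl : ∀ {n} (G : Graph n) u → distSeidel G u u ≡ 0ℚ
distSeidel-refl G u = cong₂ seidelEntry (δ-refl u) (dist-refl G u)

distSeidel-double : ∀ {n} (G : Graph n) → 2 ≤ n → Connected G → ∀ i j →
  distSeidel (double G) i j ≡ distSeidel G (proj {n} i) (proj j) + ℕtoℚ 3 * (δ i j - δ (proj {n} i) (proj j))
distSeidel-double {n} G 2≤n connected i j = byCases i j (i Fin.≟ j) (proj i Fin.≟ proj j)
  where
  S = distSeidel G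

  rhs : ℚ → ℚ → ℚ → ℚ
  rhs s d e = s + ℕtoℚ 3 * (d - e)

  rhs-cong : ∀ {s s′ d d′ e e′} → s ≡ s′ → d ≡ d′ → e ≡ e′ → rhs s d e ≡ rhs s′ d′ e′
  rhs-cong refl refl refl = refl

  byCases : ∀ i j → Dec (i ≡ j) → Dec (proj {n} i ≡ proj j) →
    distSeidel (double G) i j ≡ rhs (S (proj i) (proj j)) (δ i j) (δ (proj i) (proj j))
  byCases i .i (yes refl) _ = begin
    distSeidel (double G) i i                     ≡⟨ distSeidel-refl (double G) i ⟩
    rhs 0ℚ 1ℚ 1ℚ                                  ≡⟨ rhs-cong (distSeidel-refl G (proj i)) (δ-refl i) (δ-refl (proj i)) ⟨
    rhs (S (proj i) (proj i)) (δ i i) (δ (proj i) (proj i)) ∎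
  byCases i j (no i≢j) (yes twins) = begin
    seidelEntry (δ i j) (dist (double G) i j)    ≡⟨ cong₂ seidelEntry (δ-≢ i≢j) (dist-double-twins G 2≤n connected i≢j twins) ⟩
    rhs 0ℚ 0ℚ 1ℚ                                  ≡⟨ rhs-cong (trans (cong (S (proj i)) (≡-sym twins)) (distSeidel-refl G (proj i)))
                                                              (δ-≢ i≢j) (trans (cong (δ (proj i)) (≡-sym twins)) (δ-refl (proj i))) ⟨
    rhs (S (proj i) (proj j)) (δ i j) (δ (proj i) (proj j)) ∎
  byCases i j (no i≢j) (no proj-i≢proj-j) = begin
    seidelEntry (δ i j) (dist (double G) i j)    ≡⟨ cong₂ seidelEntry (trans (δ-≢ i≢j) (≡-sym (δ-≢ proj-i≢proj-j)))
                                                                       (dist-double G connected proj-i≢proj-j) ⟩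
    S (proj i) (proj j)                           ≡⟨ solve 1 (λ s → s := s :+ con (ℕtoℚ 3) :* (con 0ℚ :- con 0ℚ))
                                                           refl (S (proj i) (proj j)) ⟩
    rhs (S (proj i) (proj j)) 0ℚ 0ℚ               ≡⟨ rhs-cong {S (proj i) (proj j)} refl (δ-≢ i≢j) (δ-≢ proj-i≢proj-j) ⟨
    rhs (S (proj i) (proj j)) (δ i j) (δ (proj i) (proj j)) ∎

charMatrix : ∀ {n} → Matrix n → ℚ → Matrix n
charMatrix M x i j = x * δ i j - M i j

charMatrix-double : ∀ {n} (G : Graph n) → 2 ≤ n → Connected G → ∀ x i j →
  charMatrix (distSeidel (double G)) x i j
    ≡ blocks (charMatrix (distSeidel G) x) (charMatrix (distSeidel G) (ℕtoℚ 3))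
             (charMatrix (distSeidel G) (ℕtoℚ 3)) (charMatrix (distSeidel G) x) i j
charMatrix-double {n} G 2≤n connected x i j =
  trans (cong (λ d → x * δ i j - d) (distSeidel-double G 2≤n connected i j)) (entry i j)
  where
  S = distSeidel G
  A B : Matrix n
  A = charMatrix S x
  B = charMatrix S (ℕtoℚ 3)

  sameHalf : ∀ d s → x * d - (s + ℕtoℚ 3 * (d - d)) ≡ x * d - s
  sameHalf = solve 3 (λ x d s → x :* d :- (s :+ con (ℕtoℚ 3) :* (d :- d)) := x :* d :- s) refl x

  otherHalf : ∀ d s → x * 0ℚ - (s + ℕtoℚ 3 * (0ℚ - d)) ≡ ℕtoℚ 3 * d - s
  otherHalf = solve 3 (λ x d s → x :* con 0ℚ :- (s :+ con (ℕtoℚ 3) :* (con 0ℚ :- d))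
                               := con (ℕtoℚ 3) :* d :- s) refl x

  entry : ∀ i j →
    x * δ i j - (S (proj {n} i) (proj {n} j) + ℕtoℚ 3 * (δ i j - δ (proj {n} i) (proj {n} j))) ≡ blocks A B B A i j
  entry i j with half {n} i | half {n} j
  ... | upper r | upper s
    rewrite proj-↑ˡ r | proj-↑ˡ s | δ-injective (Finₚ.↑ˡ-injective n _ _) r s | blocks-↑ˡ-↑ˡ A B B A r s
    = sameHalf (δ r s) (S r s)
  ... | upper r | lower s
    rewrite proj-↑ˡ r | proj-↑ʳ s | δ-≢ (↑ˡ≢↑ʳ r s) | blocks-↑ˡ-↑ʳ A B B A r s
    = otherHalf (δ r s) (S r s)
  ... | lower r | upper s
    rewrite proj-↑ʳ r | proj-↑ˡ s | δ-≢ (↑ˡ≢↑ʳ s r ∘ ≡-sym) | blocks-↑ʳ-↑ˡ A B B A r s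
    = otherHalf (δ r s) (S r s)
  ... | lower r | lower s
    rewrite proj-↑ʳ r | proj-↑ʳ s | δ-injective (Finₚ.↑ʳ-injective n _ _) r s | blocks-↑ʳ-↑ʳ A B B A r s
    = sameHalf (δ r s) (S r s)

theorem6p3 : (n : ℕ) → 2 ≤ n → (G : Graph n) → Connected G →
    (x : ℚ) →
    charPoly (distSeidel (double G)) x
      ≡ ((x - ℕtoℚ 3) ^ n) * ((ℕtoℚ 2 ^ n) * charPoly (distSeidel G) ((x + ℕtoℚ 3) * ½))
theorem6p3 n 2≤n G connected x = begin
  det (charMatrix (distSeidel (double G)) x)
    ≡⟨ det-cong (charMatrix-double G 2≤n connected x) ⟩
  det (blocks A B B A)
    ≡⟨ det-blocks-twin A B ⟩
  det (λ r s → A r s - B r s) * det (λ r s → A r s + B r s)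
    ≡⟨ cong₂ _*_ (det-scalarMatrix _ (x - ℕtoℚ 3) A-B≡scalar)
                 (det-scale (charMatrix S y) _ (ℕtoℚ 2) A+B≡scaled) ⟩
  (x - ℕtoℚ 3) ^ n * (ℕtoℚ 2 ^ n * charPoly S y) ∎
  where
  S = distSeidel G
  A B : Matrix n
  A = charMatrix S x
  B = charMatrix S (ℕtoℚ 3)
  y = (x + ℕtoℚ 3) * ½

  A-B≡scalar : ∀ r s → A r s - B r s ≡ (x - ℕtoℚ 3) * δ r s
  A-B≡scalar r s = solve 3 (λ x d e → (x :* d :- e) :- (con (ℕtoℚ 3) :* d :- e)
                                      := (x :- con (ℕtoℚ 3)) :* d)
              refl x (δ r s) (S r s)

  A+B≡scaled : ∀ r s → A r s + B r s ≡ ℕtoℚ 2 * charMatrix S y r s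
  A+B≡scaled r s = solve 3 (λ x d e → (x :* d :- e) :+ (con (ℕtoℚ 3) :* d :- e)
                               := con (ℕtoℚ 2) :* (((x :+ con (ℕtoℚ 3)) :* con ½) :* d :- e))
              refl x (δ r s) (S r s)
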